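{- Consider an arbitrary stable matching instance with one-sided uncertainty and its $B$-optimal stable matching $M$. Every algorithm needs at least $n-1$ set queries to verify that $M$ is stable and $B$-optimal.
   Context: Two disjoint sets $A$, $B$ of agents with $|A|=|B|=n$. Each $a\in A$ has a strict total order $\prec_a$ on $B$ and each $b\in B$ has a strict total order $\prec_b$ on $A$ ($x\prec_y z$: $y$ prefers $x$ to $z$). A matching is a bijection between $A$ and $B$; it is stable if there is no pair $(a,b)$, $b\neq M(a)$, with $a$ preferring $b$ to $M(a)$ and $b$ preferring $a$ to $M(b)$. A stable matching is $B$-optimal if every agent of $B$ weakly prefers its partner in it to its partner in any other stable matching. One-sided uncertainty: the orders $\prec_a$ ($a\in A$) are known, the orders $\prec_b$ ($b\in B$) are unknown and learned only via queries. A set query $\mathit{top}(b,S)$ for $b\in B$ and $S\subseteq A$ returns $b$'s most preferred element of $S$. A query set verifies the property if, for every $B$-side preference profile consistent with the $A$-side preferences and the answers, $M$ is stable and $B$-optimal. -}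

module Defs where

open import Data.Nat using (ℕ; _<_; _≤_)
open import Data.Fin using (Fin; toℕ)
open import Data.Fin.Subset using (Subset; _∈_)
open import Data.Fin.Permutation using (Permutation′; _⟨$⟩ʳ_; _⟨$⟩ˡ_)
open import Data.Product using (_×_; _,_; ∃; ∃-syntax)
open import Data.List using (List)
open import Data.List.Membership.Propositional renaming (_∈_ to _∈ₗ_)
open import Relation.Binary.PropositionalEquality using (_≡_; _≢_)
open import Relation.Nullary using (¬_)
open import Function.Definitions using (Injective)

-- Agents: A = Fin n, B = Fin n.
-- A strict total order on Fin n, given by an injective rank function
-- (rank 0 = most preferred); x ≺ z iff rank x < rank z.
record Pref (n : ℕ) : Set where
  field
    rank  : Fin n → Fin n
    rank-inj : Injective _≡_ _≡_ rank
open Pref public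

_≺[_]_ : ∀ {n} → Fin n → Pref n → Fin n → Set
x ≺[ p ] z = toℕ (rank p x) < toℕ (rank p z)

_≼[_]_ : ∀ {n} → Fin n → Pref n → Fin n → Set
x ≼[ p ] z = toℕ (rank p x) ≤ toℕ (rank p z)

Profile : ℕ → Set
Profile n = Fin n → Pref n

-- A matching is a bijection A → B; M ⟨$⟩ʳ a = M(a) ∈ B, M ⟨$⟩ˡ b = M(b) ∈ A.
Matching : ℕ → Set
Matching n = Permutation′ n

Blocking : ∀ {n} → Profile n → Profile n → Matching n → Fin n → Fin n → Set
Blocking pA pB M a b =
  (b ≢ M ⟨$⟩ʳ a) × (b ≺[ pA a ] (M ⟨$⟩ʳ a)) × (a ≺[ pB b ] (M ⟨$⟩ˡ b))

Stable : ∀ {n} → Profile n → Profile n → Matching n → Set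
Stable pA pB M = ¬ (∃[ a ] ∃[ b ] Blocking pA pB M a b)

BOptimal : ∀ {n : ℕ} → Profile n → Profile n → Matching n → Set
BOptimal {n} pA pB M =
  Stable pA pB M ×
  (∀ (M' : Matching n) → Stable pA pB M' →
     ∀ b → (M ⟨$⟩ˡ b) ≼[ pB b ] (M' ⟨$⟩ˡ b))

-- x is the most preferred element of S under p (this is the answer of top)
IsTop : ∀ {n} → Pref n → Subset n → Fin n → Set
IsTop p S x = (x ∈ S) × (∀ y → y ∈ S → y ≢ x → x ≺[ p ] y)

Query : ℕ → Set
Query n = Fin n × Subset n

Consistent : ∀ {n} → List (Query n) → Profile n → Profile n → Set
Consistent Q pB pB' =
  ∀ b S → (b , S) ∈ₗ Q → ∀ x → IsTop (pB b) S x → IsTop (pB' b) S x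

Verifies : ∀ {n} → Profile n → Profile n → Matching n → List (Query n) → Set
Verifies pA pB M Q =
  ∀ (pB' : Profile _) → Consistent Q pB pB' → BOptimal pA pB' M

-- With fewer than n − 1 queries, two agents b₁ ≠ b₂ of B are never queried. Change only their
-- preferences, so that each ranks its M-partner last: all answers stay the same, and now every
-- a ∈ A is preferred by b₁ or by b₂ to that agent's partner. This cannot happen in a B-optimal
-- stable matching M: if it did, let s(a) be a's favourite among the agents of B preferring a to
-- their partner; the map a ↦ M⁻¹(s(a)) has a cycle, and giving every a on it the partner s(a)
-- yields a stable matching that the B-agents on the cycle strictly prefer to M.

{-# OPTIONS --safe #-}
module Submission where

open import Defs
open import Data.Nat using (ℕ; _≤_; _∸_)
open import Data.List using (List; length)

open import Data.Nat.Base using (zero; suc; _+_; _<_; z≤n; s<s)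
open import Data.Nat.Properties
  using (n<1+n; n≮n; +-comm; m∸n+n≡m; +-suc; ≮⇒≥; <⇒≱; <⇒≤; <-≤-trans; ≤-reflexive)
open import Data.Fin.Base as Fin using (Fin; toℕ; fromℕ)
open import Data.Fin.Properties
  using (_≟_; _<?_; pigeonhole; ¬∀⟶∃¬; <⇒≢; ≤∧≢⇒<; ≤fromℕ)
open import Data.Fin.Permutation
  using (Permutation′; _⟨$⟩ʳ_; _⟨$⟩ˡ_; permutation; inverseˡ; inverseʳ; transpose; flip; _∘ₚ_)
open import Data.List.Base using (_∷_; map; filter; lookup; allFin)
open import Data.List.Properties using (length-map)
open import Data.List.Extrema.Nat using (argmin; argmin-all; f[argmin]≤f[xs])
open import Data.List.Membership.Propositional using (_∈_; _∉_)
open import Data.List.Membership.Propositional.Properties using (∈-map⁺; ∈-filter⁺; ∈-allFin)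
open import Data.List.Relation.Unary.All as All using ()
open import Data.List.Relation.Unary.All.Properties using (all-filter)
open import Data.List.Relation.Unary.Any using (here; there; index)
open import Data.List.Relation.Unary.Any.Properties using (lookup-index)
open import Data.Product using (∃; ∃₂; _×_; _,_; proj₁; proj₂)
open import Data.Bool using (if_then_else_)
open import Function.Base using (_∘_)
open import Function.Bundles using (Injection)
open import Function.Properties.Inverse using (↔⇒↣)
open import Relation.Nullary using (¬_; yes; no; does)
open import Relation.Nullary.Decidable using (dec-true; dec-false)
open import Relation.Unary using (Pred; Decidable)
open import Relation.Binary.PropositionalEquality
open ≡-Reasoning

import Function.Endo.Propositional as Endo
import Data.List.Membership.DecPropositional as DecMembership

⟨$⟩ʳ-injective : ∀ {n} (π : Permutation′ n) {x y} → π ⟨$⟩ʳ x ≡ π ⟨$⟩ʳ y → x ≡ y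
⟨$⟩ʳ-injective π = Injection.injective (↔⇒↣ π)

⟨$⟩ˡ-injective : ∀ {n} (π : Permutation′ n) {x y} → π ⟨$⟩ˡ x ≡ π ⟨$⟩ˡ y → x ≡ y
⟨$⟩ˡ-injective π = ⟨$⟩ʳ-injective (flip π)

∃∉ : ∀ {n} (xs : List (Fin n)) → length xs < n → ∃ λ x → x ∉ xs
∃∉ {n} xs |xs|<n = ¬∀⟶∃¬ n (_∈ xs) (_∈? xs) covering⇒⊥
  where
  open DecMembership (_≟_ {n}) using (_∈?_)
  covering⇒⊥ : ¬ (∀ x → x ∈ xs)
  covering⇒⊥ covers with pigeonhole |xs|<n (index ∘ covers)
  ... | i , j , i<j , same-index = <⇒≢ i<j (begin
    i                             ≡⟨ lookup-index (covers i) ⟩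
    lookup xs (index (covers i))  ≡⟨ cong (lookup xs) same-index ⟩
    lookup xs (index (covers j))  ≡⟨ lookup-index (covers j) ⟨
    j                             ∎)

∃₂∉ : ∀ {n} (xs : List (Fin n)) → suc (length xs) < n →
      ∃₂ λ x y → x ≢ y × x ∉ xs × y ∉ xs
∃₂∉ xs 1+|xs|<n =
  let x , x∉xs = ∃∉ xs (<⇒≤ 1+|xs|<n)
      y , y∉x∷xs = ∃∉ (x ∷ xs) 1+|xs|<n
  in x , y , (λ x≡y → y∉x∷xs (here (sym x≡y))) , x∉xs , y∉x∷xs ∘ there

∃-argmin : ∀ {n p} {P : Pred (Fin n) p} → Decidable P → (r : Fin n → ℕ) →
           ∃ P → ∃ λ x → P x × (∀ y → P y → r x ≤ r y)
∃-argmin {n} P? r (x , px) =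
  argmin r x xs ,
  argmin-all r px (all-filter P? (allFin n)) ,
  λ y py → All.lookup (f[argmin]≤f[xs] x xs) (∈-filter⁺ P? (∈-allFin y) py)
  where xs = filter P? (allFin n)

module _ {n : ℕ} (f : Fin n → Fin n) where
  open Endo (Fin n) using (_^_; ^-homo)

  ^-commute : ∀ i j x → (f ^ i) ((f ^ j) x) ≡ (f ^ j) ((f ^ i) x)
  ^-commute i j x = begin
    (f ^ i) ((f ^ j) x)  ≡⟨ cong-app (^-homo f i j) x ⟨
    (f ^ (i + j)) x      ≡⟨ cong (λ k → (f ^ k) x) (+-comm i j) ⟩
    (f ^ (j + i)) x      ≡⟨ cong-app (^-homo f j i) x ⟩
    (f ^ j) ((f ^ i) x)  ∎

  ∃-periodic-point : Fin n → ∃₂ λ e c → (f ^ suc e) c ≡ c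
  ∃-periodic-point x with pigeonhole (n<1+n n) (λ i → (f ^ toℕ i) x)
  ... | i , j , i<j , fⁱx≡fʲx = k , (f ^ toℕ i) x , (begin
    (f ^ suc k) ((f ^ toℕ i) x)  ≡⟨ cong-app (^-homo f (suc k) (toℕ i)) x ⟨
    (f ^ (suc k + toℕ i)) x      ≡⟨ cong (λ m → (f ^ m) x) (trans (sym (+-suc k (toℕ i))) (m∸n+n≡m i<j)) ⟩
    (f ^ toℕ j) x                ≡⟨ fⁱx≡fʲx ⟨
    (f ^ toℕ i) x                ∎)
    where k = toℕ j ∸ suc (toℕ i)

module CycleRotation {n : ℕ} (f : Fin n → Fin n) (e : ℕ) where
  open Endo (Fin n) using (_^_)

  Periodic : Fin n → Set
  Periodic x = (f ^ suc e) x ≡ x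

  periodic? : Decidable Periodic
  periodic? x = (f ^ suc e) x ≟ x

  private
    periodic-f : ∀ {x} → Periodic x → Periodic (f x)
    periodic-f {x} p = trans (^-commute f (suc e) 1 x) (cong f p)

    periodic-^e : ∀ {x} → Periodic x → Periodic ((f ^ e) x)
    periodic-^e {x} p = trans (^-commute f (suc e) e x) (cong (f ^ e) p)

    ^e-f : ∀ {x} → Periodic x → (f ^ e) (f x) ≡ x
    ^e-f {x} p = trans (^-commute f e 1 x) p

    -- opaque, so that `with periodic? x` in later proofs does not abstract inside onCycle
    opaque
      onCycle : (Fin n → Fin n) → Fin n → Fin n
      onCycle g x = if does (periodic? x) then g x else x

      onCycle-periodic : ∀ g {x} → Periodic x → onCycle g x ≡ g x
      onCycle-periodic g {x} p rewrite dec-true (periodic? x) p = refl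

      onCycle-aperiodic : ∀ g {x} → ¬ Periodic x → onCycle g x ≡ x
      onCycle-aperiodic g {x} np rewrite dec-false (periodic? x) np = refl

    onCycle-inverse : ∀ g h → (∀ {x} → Periodic x → Periodic (h x)) →
                      (∀ {x} → Periodic x → g (h x) ≡ x) →
                      ∀ x → onCycle g (onCycle h x) ≡ x
    onCycle-inverse g h h-periodic g∘h≡id x with periodic? x
    ... | yes p = begin
      onCycle g (onCycle h x)  ≡⟨ cong (onCycle g) (onCycle-periodic h p) ⟩
      onCycle g (h x)          ≡⟨ onCycle-periodic g (h-periodic p) ⟩
      g (h x)                  ≡⟨ g∘h≡id p ⟩
      x                        ∎
    ... | no np = trans (cong (onCycle g) (onCycle-aperiodic h np)) (onCycle-aperiodic g np)

  rotation : Permutation′ n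
  rotation = permutation (onCycle f) (onCycle (f ^ e))
    (onCycle-inverse f (f ^ e) periodic-^e (λ p → p))
    (onCycle-inverse (f ^ e) f periodic-f ^e-f)

  rotation-periodic : ∀ {x} → Periodic x → rotation ⟨$⟩ʳ x ≡ f x
  rotation-periodic = onCycle-periodic f

  rotation-aperiodic : ∀ {x} → ¬ Periodic x → rotation ⟨$⟩ʳ x ≡ x
  rotation-aperiodic = onCycle-aperiodic f

  f∘rotation⁻¹-periodic : ∀ {x} → Periodic x → f (rotation ⟨$⟩ˡ x) ≡ x
  f∘rotation⁻¹-periodic p = trans (cong f (onCycle-periodic (f ^ e) p)) p

  rotation⁻¹-aperiodic : ∀ {x} → ¬ Periodic x → rotation ⟨$⟩ˡ x ≡ x
  rotation⁻¹-aperiodic = onCycle-aperiodic (f ^ e)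

rankedBy : ∀ {n} → Permutation′ n → Pref n
rankedBy π = record { rank = π ⟨$⟩ʳ_ ; rank-inj = ⟨$⟩ʳ-injective π }

RanksLast : ∀ {n} → Pref n → Fin n → Set
RanksLast p x = ∀ y → y ≢ x → y ≺[ p ] x

lastPref : ∀ {n} → Fin (suc n) → Pref (suc n)
lastPref {n} x = rankedBy (transpose x (fromℕ n))

lastPref-ranksLast : ∀ {n} (x : Fin (suc n)) → RanksLast (lastPref x) x
lastPref-ranksLast {n} x y y≢x = subst (λ r → rank (lastPref x) y Fin.< r) (sym x↦last)
  (≤∧≢⇒< (≤fromℕ _) (λ y↦last → y≢x (rank-inj (lastPref x) (trans y↦last (sym x↦last)))))
  where
  x↦last : rank (lastPref x) x ≡ fromℕ n
  x↦last rewrite dec-true (x ≟ x) refl = refl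

Desires : ∀ {n} → Profile n → Matching n → Fin n → Fin n → Set
Desires pB M b a = a ≺[ pB b ] (M ⟨$⟩ˡ b)

Desired : ∀ {n} → Profile n → Matching n → Fin n → Set
Desired pB M a = ∃ λ b → Desires pB M b a

IsBestDesirer : ∀ {n} → Profile n → Profile n → Matching n → Fin n → Fin n → Set
IsBestDesirer pA pB M a b = Desires pB M b a × (∀ b′ → Desires pB M b′ a → b ≼[ pA a ] b′)

module _ {n : ℕ} (pA pB : Profile n) where

  stable⇒partner-≼ : ∀ (M : Matching n) {a b} →
    Stable pA pB M → Desires pB M b a → (M ⟨$⟩ʳ a) ≼[ pA a ] b
  stable⇒partner-≼ M {a} {b} stable desires =
    ≮⇒≥ λ b≺Ma → stable (a , b , b≢Ma , b≺Ma , desires)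
    where
    b≢Ma : b ≢ M ⟨$⟩ʳ a
    b≢Ma b≡Ma = n≮n _ (subst (a ≺[ pB b ]_) (trans (cong (M ⟨$⟩ˡ_) b≡Ma) (inverseˡ M)) desires)

  improves⇒stable : ∀ (M M′ : Matching n) →
    (∀ b → (M′ ⟨$⟩ˡ b) ≼[ pB b ] (M ⟨$⟩ˡ b)) →
    (∀ {a b} → Desires pB M b a → (M′ ⟨$⟩ʳ a) ≼[ pA a ] b) →
    Stable pA pB M′
  improves⇒stable _ _ improves partner-≼ (a , b , _ , b≺M′a , a≺M′⁻¹b) =
    <⇒≱ b≺M′a (partner-≼ (<-≤-trans a≺M′⁻¹b (improves b)))

  module Rotation (M : Matching n)
    (s : Fin n → Fin n)
    (s-best : ∀ a → IsBestDesirer pA pB M a (s a))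
    (e : ℕ) where

    open CycleRotation (λ a → M ⟨$⟩ˡ s a) e public

    rotated : Matching n
    rotated = rotation ∘ₚ M

    rotated-periodic : ∀ {a} → Periodic a → rotated ⟨$⟩ʳ a ≡ s a
    rotated-periodic p = trans (cong (M ⟨$⟩ʳ_) (rotation-periodic p)) (inverseʳ M)

    rotated-aperiodic : ∀ {a} → ¬ Periodic a → rotated ⟨$⟩ʳ a ≡ M ⟨$⟩ʳ a
    rotated-aperiodic np = cong (M ⟨$⟩ʳ_) (rotation-aperiodic np)

    rotated-improves-on-cycle : ∀ b → Periodic (M ⟨$⟩ˡ b) →
      (rotated ⟨$⟩ˡ b) ≺[ pB b ] (M ⟨$⟩ˡ b)
    rotated-improves-on-cycle b p = subst (λ b′ → Desires pB M b′ a) s[a]≡b (proj₁ (s-best a))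
      where
      a = rotated ⟨$⟩ˡ b
      s[a]≡b : s a ≡ b
      s[a]≡b = ⟨$⟩ˡ-injective M (f∘rotation⁻¹-periodic p)

    rotated-improves : ∀ b → (rotated ⟨$⟩ˡ b) ≼[ pB b ] (M ⟨$⟩ˡ b)
    rotated-improves b with periodic? (M ⟨$⟩ˡ b)
    ... | yes p = <⇒≤ (rotated-improves-on-cycle b p)
    ... | no np = ≤-reflexive (cong (toℕ ∘ rank (pB b)) (rotation⁻¹-aperiodic np))

    rotated-stable : Stable pA pB M → Stable pA pB rotated
    rotated-stable stable = improves⇒stable M rotated rotated-improves partner-≼
      where
      partner-≼ : ∀ {a b} → Desires pB M b a → (rotated ⟨$⟩ʳ a) ≼[ pA a ] b
      partner-≼ {a} {b} desires with periodic? a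
      ... | yes p = subst (_≼[ pA a ] b) (sym (rotated-periodic p)) (proj₂ (s-best a) b desires)
      ... | no np = subst (_≼[ pA a ] b) (sym (rotated-aperiodic np)) (stable⇒partner-≼ M stable desires)

best-desirer : ∀ {n} (pA pB : Profile n) (M : Matching n) a →
  Desired pB M a → ∃ (IsBestDesirer pA pB M a)
best-desirer pA pB M a =
  ∃-argmin (λ b → rank (pB b) a <? rank (pB b) (M ⟨$⟩ˡ b)) (toℕ ∘ rank (pA a))

BOptimal⇒¬all-desired : ∀ {n} (pA pB : Profile (suc n)) (M : Matching (suc n)) →
  BOptimal pA pB M → ¬ (∀ a → Desired pB M a)
BOptimal⇒¬all-desired {n} pA pB M (stable , optimal) all-desired =
  let e , c , c-periodic = ∃-periodic-point (λ a → M ⟨$⟩ˡ s a) Fin.zero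
      open Rotation pA pB M s (proj₂ ∘ best) e
      b = M ⟨$⟩ʳ c
  in <⇒≱ (rotated-improves-on-cycle b (subst Periodic (sym (inverseˡ M)) c-periodic))
         (optimal rotated (rotated-stable stable) b)
  where
  best : ∀ a → ∃ (IsBestDesirer pA pB M a)
  best a = best-desirer pA pB M a (all-desired a)

  s : Fin (suc n) → Fin (suc n)
  s = proj₁ ∘ best

ranksPartnerLast⇒all-desired : ∀ {n} (pB : Profile n) (M : Matching n) {b₁ b₂} → b₁ ≢ b₂ →
  RanksLast (pB b₁) (M ⟨$⟩ˡ b₁) → RanksLast (pB b₂) (M ⟨$⟩ˡ b₂) → ∀ a → Desired pB M a
ranksPartnerLast⇒all-desired pB M {b₁} b₁≢b₂ last₁ last₂ a with a ≟ M ⟨$⟩ˡ b₁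
... | no a≢M⁻¹b₁ = b₁ , last₁ a a≢M⁻¹b₁
... | yes a≡M⁻¹b₁ = _ , last₂ a (λ a≡M⁻¹b₂ → b₁≢b₂ (⟨$⟩ˡ-injective M (trans (sym a≡M⁻¹b₁) a≡M⁻¹b₂)))

module _ {n : ℕ} (xs : List (Fin n)) (p q : Profile n) where
  open DecMembership (_≟_ {n}) using (_∈?_)

  patch : Profile n
  patch b = if does (b ∈? xs) then p b else q b

  patch-∈ : ∀ {b} → b ∈ xs → patch b ≡ p b
  patch-∈ {b} b∈xs rewrite dec-true (b ∈? xs) b∈xs = refl

  patch-∉ : ∀ {b} → b ∉ xs → patch b ≡ q b
  patch-∉ {b} b∉xs rewrite dec-false (b ∈? xs) b∉xs = refl

agree⇒consistent : ∀ {n} (Q : List (Query n)) {pB pB′ : Profile n} →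
  (∀ {b} → b ∈ map proj₁ Q → pB′ b ≡ pB b) → Consistent Q pB pB′
agree⇒consistent Q agree b S bS∈Q x top =
  subst (λ p → IsTop p S x) (sym (agree (∈-map⁺ proj₁ bS∈Q))) top

lemma22 : ∀ (n : ℕ) (pA pB : Profile n) (M : Matching n) →
    BOptimal pA pB M →
    ∀ (Q : List (Query n)) → Verifies pA pB M Q →
    n ∸ 1 ≤ length Q
lemma22 zero _ _ _ _ _ _ = z≤n
lemma22 (suc n) pA pB M _ Q verifies = ≮⇒≥ λ |Q|<n →
  let b₁ , b₂ , b₁≢b₂ , b₁∉ , b₂∉ = ∃₂∉ queried
        (subst (λ k → suc k < suc n) (sym (length-map proj₁ Q)) (s<s |Q|<n))
  in BOptimal⇒¬all-desired pA pB′ M (verifies pB′ (agree⇒consistent Q (patch-∈ queried pB lastPartner)))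
       (ranksPartnerLast⇒all-desired pB′ M b₁≢b₂ (unqueried-ranksLast b₁∉) (unqueried-ranksLast b₂∉))
  where
  queried : List (Fin (suc n))
  queried = map proj₁ Q

  lastPartner : Profile (suc n)
  lastPartner b = lastPref (M ⟨$⟩ˡ b)

  pB′ : Profile (suc n)
  pB′ = patch queried pB lastPartner

  unqueried-ranksLast : ∀ {b} → b ∉ queried → RanksLast (pB′ b) (M ⟨$⟩ˡ b)
  unqueried-ranksLast b∉ =
    subst (λ p → RanksLast p _) (sym (patch-∉ queried pB lastPartner b∉)) (lastPref-ranksLast _)
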